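{- For all positive integers $k$ and $n$, \[ \sum_{j=-\infty}^{\infty} (-1)^j\, b_k\!\left(n-\tfrac{j(3j-1)}{2}\right)=\frac{1+(-1)^{[n \equiv 0 \pmod k]+1}}{2}\cdot \frac{n}{k}. \]
   Context: A partition of $n$ is a weakly decreasing finite sequence of positive integers summing to $n$. $b_k(n)$ (for $n\ge1$) is the sum, over all partitions $\lambda$ of $n$, of the sum of the distinct part values of $\lambda$ that appear at least $k$ times in $\lambda$; $b_k(m)=0$ for $m\le 0$ (so the sum is finite). $[P]$ is the Iverson bracket: $1$ if $P$ holds, $0$ otherwise. -}

module Defs where

open import Data.Nat as ℕ using (ℕ; zero; suc; _∸_; _⊓_; _≤?_; NonZero)
open import Data.Nat.DivMod as ℕD using ()
open import Data.Integer as ℤ using (ℤ; +_; -[1+_]; ∣_∣)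
open import Data.Integer.DivMod as ℤD using ()
open import Data.List using (List; []; _∷_; [_]; map; concatMap; applyUpTo; filter; length)
open import Data.Nat.ListAction using (sum)
open import Relation.Nullary using (Dec; yes; no)
open import Relation.Binary.PropositionalEquality using (_≡_)

-- Partitions are represented as weakly decreasing lists of positive integers.
-- go f m n : all partitions of n whose parts are all ≤ m (listed with largest part
-- first), using fuel f (f ≥ n suffices since every part is ≥ 1).
go : ℕ → ℕ → ℕ → List (List ℕ)
go _       m zero    = [ [] ]
go zero    m (suc n) = []
go (suc f) m (suc n) =
  concatMap (λ p → map (p ∷_) (go f p (suc n ∸ p))) (applyUpTo suc (m ⊓ suc n))

partitions : ℕ → List (List ℕ)
partitions n = go n n n

count : ℕ → List ℕ → ℕ
count v l = length (filter (ℕ._≟ v) l)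

-- Sum of the distinct part values of λ (parts lie in 1..n) that appear at least k times.
distinctRepeatedSum : ℕ → ℕ → List ℕ → ℕ
distinctRepeatedSum k n λp =
  sum (map (λ v → indicator v) (applyUpTo suc n))
  where
  indicator : ℕ → ℕ
  indicator v with k ≤? count v λp
  ... | yes _ = v
  ... | no  _ = 0

bℕ : ℕ → ℕ → ℕ
bℕ k n = sum (map (distinctRepeatedSum k n) (partitions n))

b : ℕ → ℤ → ℤ
b k (+ zero)  = + 0
b k (+ suc m) = + bℕ k (suc m)
b k -[1+ _ ]  = + 0

signPow : ℤ → ℤ
signPow j = (ℤ.- (+ 1)) ℤ.^ ∣ j ∣

-- generalized pentagonal number j(3j-1)/2 (exact division: j(3j-1) is even)
pent : ℤ → ℤ
pent j = (j ℤ.* (+ 3 ℤ.* j ℤ.- + 1)) ℤD./ (+ 2)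

symSum : (ℤ → ℤ) → ℕ → ℤ
symSum f zero    = f (+ 0)
symSum f (suc N) = symSum f N ℤ.+ f (+ suc N) ℤ.+ f -[1+ N ]

iverson : ∀ {p} {P : Set p} → Dec P → ℕ
iverson (yes _) = 1
iverson (no _)  = 0

summand : ℕ → ℕ → ℤ → ℤ
summand k n j = signPow j ℤ.* b k (+ n ℤ.- pent j)

-- RHS: (1 + (-1)^([n ≡ 0 mod k] + 1))/2 · n/k.
-- The first factor is 0 or 1; when it is 1, k ∣ n so the ℕ-division n / k is exact.
rhs : (k n : ℕ) → .{{NonZero k}} → ℤ
rhs k n = ((+ 1 ℤ.+ (ℤ.- (+ 1)) ℤ.^ (iverson (n ℕD.% k ℕ.≟ 0) ℕ.+ 1)) ℤD./ (+ 2))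
          ℤ.* + (n ℕD./ k)

-- Removing t copies of v from a partition of n with at least t parts equal to v leaves an
-- arbitrary partition of n - t v, so  Σ_n b_k(n) q^n = Σ_v v q^(k v) / (q;q)_∞.  Multiplying by
-- (q;q)_∞ = Σ_j (-1)^j q^(j(3j-1)/2) (Euler's pentagonal number theorem) leaves Σ_v v q^(k v),
-- whose coefficient of q^n is n/k if k ∣ n and 0 otherwise.
-- The count of partitions with repeated parts is obtained from the recurrence
-- (1 - q^m) P_m = P_(m-1) for the series P_m of partitions into parts ≤ m, using that
-- multiplication by 1 - q^m is injective on coefficient sequences.
-- Only coefficients up to degree N matter, so everything is done with partitions into parts ≤ N,
-- whose series P_N satisfies (q;q)_N P_N = 1, and with Euler's theorem in Shanks' finite form
--   Σ_{k ≤ N} (-1)^k q^(N k + k(k+1)/2) (q^(k+1);q)_(N-k) = Σ_{|j| ≤ N} (-1)^j q^(j(3j-1)/2),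
-- whose terms with k ≥ 1 vanish below degree N + 1.

module Submission where

open import Defs
open import Data.Nat as ℕ using (ℕ; zero; suc; _≤_; _<_; z≤n; s≤s; NonZero)
import Data.Nat.Properties as ℕ
open import Data.Integer as ℤ using (ℤ; +_; -[1+_]; 0ℤ; 1ℤ; _+_; _*_; -_; _-_)
open import Data.Integer.Properties
import Data.Integer.DivMod as ZD
import Data.Nat.DivMod as ℕ
open import Data.Integer.Tactic.RingSolver using (solve-∀)
open import Data.Nat.Tactic.RingSolver renaming (solve-∀ to ℕ-solve-∀)
open import Data.List using (List; []; _∷_; [_]; _++_; map; concatMap; applyUpTo; upTo)
open import Data.List.Properties using (applyUpTo-∷ʳ; filter-accept; filter-reject)
open import Data.List.Membership.Propositional using (_∈_)
open import Data.List.Membership.Propositional.Properties using (∈-applyUpTo⁻; ∈-upTo⁻)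
open import Data.List.Relation.Unary.Any using (here; there)
open import Data.Nat.ListAction using (sum)
open import Data.Product using (Σ-syntax; _,_; proj₁)
open import Function using (_∘_; case_of_)
open import Data.Sum using (inj₁; inj₂)
open import Relation.Binary.PropositionalEquality hiding ([_])
open import Relation.Nullary using (Dec; yes; no; contradiction)

private variable A B : Set

-- Finite sums

∑ : List A → (A → ℤ) → ℤ
∑ []       h = 0ℤ
∑ (x ∷ xs) h = h x + ∑ xs h

infix 5 ∑
syntax ∑ xs (λ x → e) = ∑[ x ∈ xs ] e

∑-cong : {xs : List A} {h g : A → ℤ} → (∀ {x} → x ∈ xs → h x ≡ g x) → ∑ xs h ≡ ∑ xs g
∑-cong {xs = []}     eq = refl
∑-cong {xs = x ∷ xs} eq = cong₂ _+_ (eq (here refl)) (∑-cong (eq ∘ there))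

∑-++ : (xs ys : List A) (h : A → ℤ) → ∑ (xs ++ ys) h ≡ ∑ xs h + ∑ ys h
∑-++ []       ys h = sym (+-identityˡ _)
∑-++ (x ∷ xs) ys h = trans (cong (_+_ (h x)) (∑-++ xs ys h)) (sym (+-assoc (h x) _ _))

∑-+ : (xs : List A) (h g : A → ℤ) → ∑[ x ∈ xs ] (h x + g x) ≡ ∑ xs h + ∑ xs g
∑-+ []       h g = refl
∑-+ (x ∷ xs) h g = trans (cong (_+_ (h x + g x)) (∑-+ xs h g)) (interchange (h x) (g x) _ _)
  where
  interchange : ∀ a b c d → a + b + (c + d) ≡ a + c + (b + d)
  interchange = solve-∀

∑-*ˡ : (c : ℤ) (xs : List A) (h : A → ℤ) → ∑[ x ∈ xs ] (c * h x) ≡ c * ∑ xs h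
∑-*ˡ c []       h = sym (*-zeroʳ c)
∑-*ˡ c (x ∷ xs) h = trans (cong (_+_ (c * h x)) (∑-*ˡ c xs h)) (sym (*-distribˡ-+ c (h x) _))

∑-0 : (xs : List A) → ∑[ x ∈ xs ] 0ℤ ≡ 0ℤ
∑-0 []       = refl
∑-0 (x ∷ xs) = trans (+-identityˡ _) (∑-0 xs)

∑-comm : (xs : List A) (ys : List B) (F : A → B → ℤ) →
         ∑[ x ∈ xs ] ∑[ y ∈ ys ] F x y ≡ ∑[ y ∈ ys ] ∑[ x ∈ xs ] F x y
∑-comm []       ys F = sym (∑-0 ys)
∑-comm (x ∷ xs) ys F =
  trans (cong (_+_ (∑ ys (F x))) (∑-comm xs ys F)) (sym (∑-+ ys (F x) (λ y → ∑[ x ∈ xs ] F x y)))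

∑-map : (f : A → B) (xs : List A) (h : B → ℤ) → ∑ (map f xs) h ≡ ∑ xs (h ∘ f)
∑-map f []       h = refl
∑-map f (x ∷ xs) h = cong (_+_ (h (f x))) (∑-map f xs h)

∑-concatMap : (F : A → List B) (xs : List A) (h : B → ℤ) →
              ∑ (concatMap F xs) h ≡ ∑[ x ∈ xs ] ∑ (F x) h
∑-concatMap F []       h = refl
∑-concatMap F (x ∷ xs) h =
  trans (∑-++ (F x) (concatMap F xs) h) (cong (_+_ (∑ (F x) h)) (∑-concatMap F xs h))

pos-sum-map : (g : A → ℕ) (xs : List A) → + sum (map g xs) ≡ ∑[ x ∈ xs ] + g x
pos-sum-map g []       = refl
pos-sum-map g (x ∷ xs) = trans (pos-+ (g x) _) (cong (_+_ (+ g x)) (pos-sum-map g xs))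

∑-applyUpTo-suc : (f : ℕ → A) (K : ℕ) (h : A → ℤ) →
                  ∑ (applyUpTo f (suc K)) h ≡ ∑ (applyUpTo f K) h + h (f K)
∑-applyUpTo-suc f K h = begin
  ∑ (applyUpTo f (suc K)) h            ≡⟨ cong (λ xs → ∑ xs h) (sym (applyUpTo-∷ʳ f K)) ⟩
  ∑ (applyUpTo f K ++ [ f K ]) h       ≡⟨ ∑-++ (applyUpTo f K) [ f K ] h ⟩
  ∑ (applyUpTo f K) h + (h (f K) + 0ℤ) ≡⟨ cong (_+_ (∑ (applyUpTo f K) h)) (+-identityʳ (h (f K))) ⟩
  ∑ (applyUpTo f K) h + h (f K)        ∎
  where open ≡-Reasoning

∑-telescope : (W : ℕ → ℤ) (K : ℕ) → ∑[ k ∈ upTo K ] (W k - W (suc k)) ≡ W 0 - W K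
∑-telescope W zero    = sym (+-inverseʳ (W 0))
∑-telescope W (suc K) = begin
  ∑[ k ∈ upTo (suc K) ] (W k - W (suc k))            ≡⟨ ∑-applyUpTo-suc (λ k → k) K _ ⟩
  (∑[ k ∈ upTo K ] (W k - W (suc k))) + (W K - W (suc K)) ≡⟨ cong (_+ (W K - W (suc K))) (∑-telescope W K) ⟩
  W 0 - W K + (W K - W (suc K))                       ≡⟨ cancel (W 0) (W K) (W (suc K)) ⟩
  W 0 - W (suc K)                                     ∎
  where
  open ≡-Reasoning
  cancel : ∀ a b c → a - b + (b - c) ≡ a - c
  cancel = solve-∀

∑-range-cong : {K : ℕ} {h g : ℕ → ℤ} → (∀ {v} → 1 ≤ v → v ≤ K → h v ≡ g v) →
               ∑ (applyUpTo suc K) h ≡ ∑ (applyUpTo suc K) g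
∑-range-cong {K} eq = ∑-cong {xs = applyUpTo suc K} λ v∈ → case ∈-applyUpTo⁻ suc v∈ of λ where
  (i , i<K , refl) → eq (s≤s z≤n) i<K

∑-range-extend : {K K′ : ℕ} (h : ℕ → ℤ) → K ≤ K′ → (∀ v → K < v → h v ≡ 0ℤ) →
                 ∑ (applyUpTo suc K′) h ≡ ∑ (applyUpTo suc K) h
∑-range-extend {K} {K′} h K≤K′ vanish with ℕ.m≤n⇒m<n∨m≡n K≤K′
... | inj₂ refl = refl
... | inj₁ K<K′ with K′
...   | suc K″ = begin
  ∑ (applyUpTo suc (suc K″)) h          ≡⟨ ∑-applyUpTo-suc suc K″ h ⟩
  ∑ (applyUpTo suc K″) h + h (suc K″)
    ≡⟨ cong₂ _+_ (∑-range-extend h (ℕ.≤-pred K<K′) vanish) (vanish (suc K″) K<K′) ⟩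
  ∑ (applyUpTo suc K) h + 0ℤ            ≡⟨ +-identityʳ _ ⟩
  ∑ (applyUpTo suc K) h                 ∎
  where open ≡-Reasoning

∑-range-single : {K q : ℕ} (h : ℕ → ℤ) → 1 ≤ q → q ≤ K → (∀ v → v ≢ q → h v ≡ 0ℤ) →
                 ∑ (applyUpTo suc K) h ≡ h q
∑-range-single {K} {suc q′} h _ q≤K vanish = begin
  ∑ (applyUpTo suc K) h                     ≡⟨ ∑-range-extend h q≤K (λ v q<v → vanish v (ℕ.>⇒≢ q<v)) ⟩
  ∑ (applyUpTo suc (suc q′)) h              ≡⟨ ∑-applyUpTo-suc suc q′ h ⟩
  ∑ (applyUpTo suc q′) h + h (suc q′)       ≡⟨ cong (_+ h (suc q′)) below ⟩
  0ℤ + h (suc q′)                           ≡⟨ +-identityˡ _ ⟩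
  h (suc q′)                                ∎
  where
  open ≡-Reasoning
  below : ∑ (applyUpTo suc q′) h ≡ 0ℤ
  below = trans (∑-range-cong (λ {v} _ v≤q′ → vanish v (ℕ.<⇒≢ (s≤s v≤q′)))) (∑-0 (applyUpTo suc q′))

symRange : ℕ → List ℤ
symRange zero    = [ + 0 ]
symRange (suc N) = + suc N ∷ -[1+ N ] ∷ symRange N

symSum-∑ : (f : ℤ → ℤ) (N : ℕ) → symSum f N ≡ ∑ (symRange N) f
symSum-∑ f zero    = sym (+-identityʳ (f (+ 0)))
symSum-∑ f (suc N) =
  trans (cong (λ s → s + f (+ suc N) + f -[1+ N ]) (symSum-∑ f N)) (rotate _ (f (+ suc N)) (f -[1+ N ]))
  where
  rotate : ∀ s a b → s + a + b ≡ a + (b + s)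
  rotate = solve-∀

-- Formal power series

-- Coefficient sequences of formal power series in q; shift s is multiplication by q^s.
Series : Set
Series = ℕ → ℤ

δ : Series
δ zero    = 1ℤ
δ (suc _) = 0ℤ

shift : ℕ → Series → Series
shift zero    f m       = f m
shift (suc s) f zero    = 0ℤ
shift (suc s) f (suc m) = shift s f m

shift-< : ∀ s f {m} → m < s → shift s f m ≡ 0ℤ
shift-< (suc s) f {zero}  _         = refl
shift-< (suc s) f {suc m} (s≤s m<s) = shift-< s f m<s

shift-≥ : ∀ s f {m} → s ≤ m → shift s f m ≡ f (m ℕ.∸ s)
shift-≥ zero    f         _       = refl
shift-≥ (suc s) f {suc m} (s≤s s≤m) = shift-≥ s f s≤m

shift-δ-≡ : ∀ s → shift s δ s ≡ 1ℤ
shift-δ-≡ s = trans (shift-≥ s δ ℕ.≤-refl) (cong δ (ℕ.n∸n≡0 s))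

shift-δ-≢ : ∀ {s x} → s ≢ x → shift s δ x ≡ 0ℤ
shift-δ-≢ {s} {x} s≢x with s ℕ.≤? x
... | no  s≰x = shift-< s δ (ℕ.≰⇒> s≰x)
... | yes s≤x with x ℕ.∸ s in eq
...   | zero  = contradiction (ℕ.≤-antisym s≤x (ℕ.m∸n≡0⇒m≤n eq)) s≢x
...   | suc _ = trans (shift-≥ s δ s≤x) (cong δ eq)

shift-local : ∀ s {f g} x → (∀ {m} → m ≤ x → f m ≡ g m) → shift s f x ≡ shift s g x
shift-local zero    x       eq = eq ℕ.≤-refl
shift-local (suc s) zero    eq = refl
shift-local (suc s) (suc x) eq = shift-local s x (eq ∘ ℕ.m≤n⇒m≤1+n)

shift-cong : ∀ s {f g} → f ≗ g → shift s f ≗ shift s g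
shift-cong s f≗g x = shift-local s x (λ {m} _ → f≗g m)

shift-0 : ∀ s x → shift s (λ _ → 0ℤ) x ≡ 0ℤ
shift-0 zero    x       = refl
shift-0 (suc s) zero    = refl
shift-0 (suc s) (suc x) = shift-0 s x

shift-- : ∀ s f g x → shift s (λ m → f m - g m) x ≡ shift s f x - shift s g x
shift-- zero    f g x       = refl
shift-- (suc s) f g zero    = refl
shift-- (suc s) f g (suc x) = shift-- s f g x

shift-*ˡ : ∀ s c f x → shift s (λ m → c * f m) x ≡ c * shift s f x
shift-*ˡ zero    c f x       = refl
shift-*ˡ (suc s) c f zero    = sym (*-zeroʳ c)
shift-*ˡ (suc s) c f (suc x) = shift-*ˡ s c f x

shift-∑ : ∀ s (xs : List A) (F : A → Series) x →
          shift s (λ m → ∑[ a ∈ xs ] F a m) x ≡ ∑[ a ∈ xs ] shift s (F a) x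
shift-∑ zero    xs F x       = refl
shift-∑ (suc s) xs F zero    = sym (∑-0 xs)
shift-∑ (suc s) xs F (suc x) = shift-∑ s xs F x

shift-shift : ∀ a b f → shift a (shift b f) ≗ shift (a ℕ.+ b) f
shift-shift zero    b f x       = refl
shift-shift (suc a) b f zero    = refl
shift-shift (suc a) b f (suc x) = shift-shift a b f x

shift-comm : ∀ a b f → shift a (shift b f) ≗ shift b (shift a f)
shift-comm a b f x = begin
  shift a (shift b f) x  ≡⟨ shift-shift a b f x ⟩
  shift (a ℕ.+ b) f x    ≡⟨ cong (λ s → shift s f x) (ℕ.+-comm a b) ⟩
  shift (b ℕ.+ a) f x    ≡⟨ shift-shift b a f x ⟨
  shift b (shift a f) x  ∎
  where open ≡-Reasoning

[1-q^_]_ : ℕ → Series → Series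
([1-q^ a ] f) m = f m - shift a f m

shift-[1-q^] : ∀ s a f → shift s ([1-q^ a ] f) ≗ [1-q^ a ] shift s f
shift-[1-q^] s a f m = trans (shift-- s f (shift a f) m) (cong (_-_ (shift s f m)) (shift-comm s a f m))

[1-q^]-injective : ∀ s {f g} → 1 ≤ s → [1-q^ s ] f ≗ [1-q^ s ] g → f ≗ g
[1-q^]-injective (suc s) {f} {g} _ eq m = agree m ℕ.≤-refl
  where
  split : ∀ h m → h m ≡ ([1-q^ suc s ] h) m + shift (suc s) h m
  split h m = sym (minus-plus (h m) (shift (suc s) h m))
    where
    minus-plus : ∀ a b → a - b + b ≡ a
    minus-plus = solve-∀
  agree : ∀ x {m} → m ≤ x → f m ≡ g m
  agree-shifted : ∀ x {m} → m ≤ x → shift (suc s) f m ≡ shift (suc s) g m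
  agree x {m} m≤x =
    trans (split f m) (trans (cong₂ _+_ (eq m) (agree-shifted x m≤x)) (sym (split g m)))
  agree-shifted x       {zero}  _         = refl
  agree-shifted (suc x) {suc m} (s≤s m≤x) = shift-local s m (λ k≤m → agree x (ℕ.≤-trans k≤m m≤x))

-- poch a l f is (q^a; q)_l · f = (1 - q^a)(1 - q^(a+1)) ⋯ (1 - q^(a+l-1)) f.
poch : ℕ → ℕ → Series → Series
poch a zero    f = f
poch a (suc l) f = poch (suc a) l ([1-q^ a ] f)

poch-cong : ∀ a l {f g} → f ≗ g → poch a l f ≗ poch a l g
poch-cong a zero    f≗g = f≗g
poch-cong a (suc l) {f} {g} f≗g =
  poch-cong (suc a) l (λ m → cong₂ _-_ (f≗g m) (shift-cong a f≗g m))

poch-- : ∀ a l f g → poch a l (λ m → f m - g m) ≗ λ m → poch a l f m - poch a l g m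
poch-- a zero    f g m = refl
poch-- a (suc l) f g m = begin
  poch (suc a) l ([1-q^ a ] (λ m → f m - g m)) m
    ≡⟨ poch-cong (suc a) l (λ m → trans (cong (_-_ (f m - g m)) (shift-- a f g m))
                                        (interchange (f m) (g m) _ _)) m ⟩
  poch (suc a) l (λ m → ([1-q^ a ] f) m - ([1-q^ a ] g) m) m
    ≡⟨ poch-- (suc a) l ([1-q^ a ] f) ([1-q^ a ] g) m ⟩
  poch a (suc l) f m - poch a (suc l) g m
    ∎
  where
  open ≡-Reasoning
  interchange : ∀ p q r s → p - q - (r - s) ≡ p - r - (q - s)
  interchange = solve-∀

poch-shift : ∀ a l s f → poch a l (shift s f) ≗ shift s (poch a l f)
poch-shift a zero    s f m = refl
poch-shift a (suc l) s f m = begin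
  poch (suc a) l ([1-q^ a ] shift s f) m
    ≡⟨ poch-cong (suc a) l (λ m → sym (shift-[1-q^] s a f m)) m ⟩
  poch (suc a) l (shift s ([1-q^ a ] f)) m
    ≡⟨ poch-shift (suc a) l s ([1-q^ a ] f) m ⟩
  shift s (poch a (suc l) f) m
    ∎
  where open ≡-Reasoning

poch-[1-q^] : ∀ a l c f → poch a l ([1-q^ c ] f) ≗ [1-q^ c ] poch a l f
poch-[1-q^] a l c f m =
  trans (poch-- a l f (shift c f) m) (cong (_-_ (poch a l f m)) (poch-shift a l c f m))

poch-suc : ∀ a l f → poch a (suc l) f ≗ [1-q^ a ℕ.+ l ] poch a l f
poch-suc a zero    f m = cong (λ c → ([1-q^ c ] f) m) (sym (ℕ.+-identityʳ a))
poch-suc a (suc l) f m =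
  trans (poch-suc (suc a) l ([1-q^ a ] f) m) (cong (λ c → ([1-q^ c ] poch a (suc l) f) m) (sym (ℕ.+-suc a l)))

-- Euler's pentagonal number theorem in Shanks' finite form

tri : ℕ → ℕ
tri zero    = 0
tri (suc k) = suc k ℕ.+ tri k

shanksExponent : ℕ → ℕ → ℕ
shanksExponent n k = n ℕ.* k ℕ.+ tri k

shanksExponent-suc : ∀ n k → shanksExponent (suc n) k ≡ shanksExponent n k ℕ.+ k
shanksExponent-suc n k = polynomial n k (tri k)
  where
  polynomial : ∀ n k t → suc n ℕ.* k ℕ.+ t ≡ n ℕ.* k ℕ.+ t ℕ.+ k
  polynomial = ℕ-solve-∀

shanksExponent-step : ∀ n k → shanksExponent n k ℕ.+ k ℕ.+ suc n ≡ shanksExponent n (suc k)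
shanksExponent-step n k = polynomial n k (tri k)
  where
  polynomial : ∀ n k t → n ℕ.* k ℕ.+ t ℕ.+ k ℕ.+ suc n ≡ n ℕ.* suc k ℕ.+ (suc k ℕ.+ t)
  polynomial = ℕ-solve-∀

pentagonal : ℤ → ℕ
pentagonal (+ zero)  = 0
pentagonal (+ suc i) = suc i ℕ.* suc i ℕ.+ tri i
pentagonal -[1+ i ]  = suc i ℕ.* suc i ℕ.+ tri (suc i)

pentagonalSum : ℕ → Series → Series
pentagonalSum N f m = ∑[ j ∈ symRange N ] signPow j * shift (pentagonal j) f m

pentagonalSum-local : ∀ N {f g} x → (∀ {m} → m ≤ x → f m ≡ g m) → pentagonalSum N f x ≡ pentagonalSum N g x
pentagonalSum-local N x eq = ∑-cong {xs = symRange N} λ {j} _ → cong (signPow j *_) (shift-local (pentagonal j) x eq)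

pentagonalSum-∑ : ∀ N (xs : List A) (c : A → ℤ) (F : A → Series) x →
  pentagonalSum N (λ m → ∑[ a ∈ xs ] c a * F a m) x ≡ ∑[ a ∈ xs ] c a * pentagonalSum N (F a) x
pentagonalSum-∑ N xs c F x = begin
  ∑[ j ∈ symRange N ] signPow j * shift (pentagonal j) (λ m → ∑[ a ∈ xs ] c a * F a m) x
    ≡⟨ ∑-cong {xs = symRange N} (λ {j} _ → term j) ⟩
  ∑[ j ∈ symRange N ] ∑[ a ∈ xs ] c a * (signPow j * shift (pentagonal j) (F a) x)
    ≡⟨ ∑-comm (symRange N) xs _ ⟩
  ∑[ a ∈ xs ] ∑[ j ∈ symRange N ] c a * (signPow j * shift (pentagonal j) (F a) x)
    ≡⟨ ∑-cong {xs = xs} (λ {a} _ → ∑-*ˡ (c a) (symRange N) _) ⟩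
  ∑[ a ∈ xs ] c a * pentagonalSum N (F a) x
    ∎
  where
  open ≡-Reasoning
  swap-scalars : ∀ s c y → s * (c * y) ≡ c * (s * y)
  swap-scalars = solve-∀
  term : ∀ j → signPow j * shift (pentagonal j) (λ m → ∑[ a ∈ xs ] c a * F a m) x
             ≡ ∑[ a ∈ xs ] c a * (signPow j * shift (pentagonal j) (F a) x)
  term j = begin
    s * shift p (λ m → ∑[ a ∈ xs ] c a * F a m) x
      ≡⟨ cong (s *_) (shift-∑ p xs (λ a m → c a * F a m) x) ⟩
    s * (∑[ a ∈ xs ] shift p (λ m → c a * F a m) x)
      ≡⟨ ∑-*ˡ s xs _ ⟨
    ∑[ a ∈ xs ] s * shift p (λ m → c a * F a m) x
      ≡⟨ ∑-cong {xs = xs} (λ {a} _ → cong (s *_) (shift-*ˡ p (c a) (F a) x)) ⟩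
    ∑[ a ∈ xs ] s * (c a * shift p (F a) x)
      ≡⟨ ∑-cong {xs = xs} (λ {a} _ → swap-scalars s (c a) _) ⟩
    ∑[ a ∈ xs ] c a * (s * shift p (F a) x)
      ∎
    where
    s : ℤ
    s = signPow j
    p : ℕ
    p = pentagonal j

pentagonalSum-shift : ∀ N s f → pentagonalSum N (shift s f) ≗ shift s (pentagonalSum N f)
pentagonalSum-shift N s f x = begin
  ∑[ j ∈ symRange N ] signPow j * shift (pentagonal j) (shift s f) x
    ≡⟨ ∑-cong {xs = symRange N} (λ {j} _ → cong (signPow j *_) (shift-comm (pentagonal j) s f x)) ⟩
  ∑[ j ∈ symRange N ] signPow j * shift s (shift (pentagonal j) f) x
    ≡⟨ ∑-cong {xs = symRange N} (λ {j} _ → sym (shift-*ˡ s (signPow j) (shift (pentagonal j) f) x)) ⟩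
  ∑[ j ∈ symRange N ] shift s (λ m → signPow j * shift (pentagonal j) f m) x
    ≡⟨ shift-∑ s (symRange N) (λ j m → signPow j * shift (pentagonal j) f m) x ⟨
  shift s (pentagonalSum N f) x
    ∎
  where open ≡-Reasoning

module _ (f : Series) where

  shanksTerm : ℕ → ℕ → Series
  shanksTerm n k m = signPow (+ k) * shift (shanksExponent n k) (poch (suc k) (n ℕ.∸ k) f) m

  boundary : ℕ → ℕ → Series
  boundary n zero    m = 0ℤ
  boundary n (suc k) m = signPow (+ k) * shift (shanksExponent n (suc k)) (poch (suc k) (n ℕ.∸ k) f) m

  boundary-[1-q^] : ∀ {n k} m → k ≤ n →
    boundary n k m ≡ - (signPow (+ k) * shift (shanksExponent n k) ([1-q^ k ] poch (suc k) (n ℕ.∸ k) f) m)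
  boundary-[1-q^] {n} {zero} m _ = sym (cong (λ x → - (1ℤ * x)) (begin
    shift (shanksExponent n 0) ([1-q^ 0 ] G) m    ≡⟨ shift-cong (shanksExponent n 0) (+-inverseʳ ∘ G) m ⟩
    shift (shanksExponent n 0) (λ _ → 0ℤ) m       ≡⟨ shift-0 (shanksExponent n 0) m ⟩
    0ℤ                                            ∎))
    where
    open ≡-Reasoning
    G : Series
    G = poch 1 n f
  boundary-[1-q^] {n} {suc k} m k<n = begin
    signPow (+ k) * shift e (poch (suc k) (n ℕ.∸ k) f) m
      ≡⟨ cong (λ l → signPow (+ k) * shift e (poch (suc k) l f) m) (ℕ.+-∸-assoc 1 k<n) ⟩
    signPow (+ k) * shift e (poch (suc (suc k)) (n ℕ.∸ suc k) ([1-q^ suc k ] f)) m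
      ≡⟨ cong (signPow (+ k) *_) (shift-cong e (poch-[1-q^] (suc (suc k)) (n ℕ.∸ suc k) (suc k) f) m) ⟩
    signPow (+ k) * shift e ([1-q^ suc k ] poch (suc (suc k)) (n ℕ.∸ suc k) f) m
      ≡⟨ negate-twice (signPow (+ k)) _ ⟨
    - (signPow (+ suc k) * shift e ([1-q^ suc k ] poch (suc (suc k)) (n ℕ.∸ suc k) f) m)
      ∎
    where
    open ≡-Reasoning
    e : ℕ
    e = shanksExponent n (suc k)
    negate-twice : ∀ s x → - ((- 1ℤ * s) * x) ≡ s * x
    negate-twice = solve-∀

  shanksTerm-suc : ∀ {n k} m → k ≤ n →
    shanksTerm (suc n) k m ≡ shanksTerm n k m + (boundary n k m - boundary n (suc k) m)
  shanksTerm-suc {n} {k} m k≤n = begin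
    s * shift (shanksExponent (suc n) k) (poch (suc k) (suc n ℕ.∸ k) f) m
      ≡⟨ cong₂ (λ a l → s * shift a (poch (suc k) l f) m) (shanksExponent-suc n k) (ℕ.+-∸-assoc 1 k≤n) ⟩
    s * shift (e ℕ.+ k) (poch (suc k) (suc (n ℕ.∸ k)) f) m
      ≡⟨ cong (s *_) (shift-cong (e ℕ.+ k) (λ x → trans (poch-suc (suc k) (n ℕ.∸ k) f x)
                        (cong (λ c → ([1-q^ c ] G) x) (cong suc (ℕ.m+[n∸m]≡n k≤n)))) m) ⟩
    s * shift (e ℕ.+ k) ([1-q^ suc n ] G) m
      ≡⟨ cong (s *_) (shift-- (e ℕ.+ k) G (shift (suc n) G) m) ⟩
    s * (shift (e ℕ.+ k) G m - shift (e ℕ.+ k) (shift (suc n) G) m)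
      ≡⟨ cong (s *_) (cong₂ _-_ (sym (shift-shift e k G m)) (shift-shift (e ℕ.+ k) (suc n) G m)) ⟩
    s * (shift e (shift k G) m - shift (e ℕ.+ k ℕ.+ suc n) G m)
      ≡⟨ cong (s *_) (cong₂ _-_ (shift-cong e (λ x → sym (minus-minus (G x) (shift k G x))) m)
                                 (cong (λ a → shift a G m) (shanksExponent-step n k))) ⟩
    s * (shift e (λ x → G x - ([1-q^ k ] G) x) m - Y)
      ≡⟨ cong (λ z → s * (z - Y)) (shift-- e G ([1-q^ k ] G) m) ⟩
    s * (shift e G m - X - Y)
      ≡⟨ distribute s (shift e G m) X Y ⟩
    shanksTerm n k m + (- (s * X) - s * Y)
      ≡⟨ cong (λ z → shanksTerm n k m + (z - s * Y)) (sym (boundary-[1-q^] m k≤n)) ⟩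
    shanksTerm n k m + (boundary n k m - boundary n (suc k) m)
      ∎
    where
    open ≡-Reasoning
    e : ℕ
    e = shanksExponent n k
    G : Series
    G = poch (suc k) (n ℕ.∸ k) f
    s X Y : ℤ
    s = signPow (+ k)
    X = shift e ([1-q^ k ] G) m
    Y = shift (shanksExponent n (suc k)) G m
    minus-minus : ∀ a b → a - (a - b) ≡ b
    minus-minus = solve-∀
    distribute : ∀ s a x b → s * (a - x - b) ≡ s * a + (- (s * x) - s * b)
    distribute = solve-∀

  shanks : ∀ n m → ∑[ k ∈ upTo (suc n) ] shanksTerm n k m ≡ pentagonalSum n f m
  shanks zero    m = refl
  shanks (suc n) m = begin
    ∑[ k ∈ upTo (suc (suc n)) ] shanksTerm (suc n) k m
      ≡⟨ ∑-applyUpTo-suc (λ k → k) (suc n) (λ k → shanksTerm (suc n) k m) ⟩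
    (∑[ k ∈ upTo (suc n) ] shanksTerm (suc n) k m) + T
      ≡⟨ cong (_+ T) (∑-cong {xs = upTo (suc n)} (λ k∈ → shanksTerm-suc m (ℕ.≤-pred (∈-upTo⁻ k∈)))) ⟩
    (∑[ k ∈ upTo (suc n) ] (shanksTerm n k m + (boundary n k m - boundary n (suc k) m))) + T
      ≡⟨ cong (_+ T) (∑-+ (upTo (suc n)) (λ k → shanksTerm n k m)
                                         (λ k → boundary n k m - boundary n (suc k) m)) ⟩
    (∑[ k ∈ upTo (suc n) ] shanksTerm n k m) + (∑[ k ∈ upTo (suc n) ] (boundary n k m - boundary n (suc k) m)) + T
      ≡⟨ cong (_+ T) (cong₂ _+_ (shanks n m) (∑-telescope (λ k → boundary n k m) (suc n))) ⟩
    pentagonalSum n f m + (0ℤ - s * shift (shanksExponent n (suc n)) (poch (suc n) (n ℕ.∸ n) f) m) + T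
      ≡⟨ cong₂ (λ a b → pentagonalSum n f m + (0ℤ - s * a) + - 1ℤ * s * b) last-boundary last-term ⟩
    pentagonalSum n f m + (0ℤ - s * shift (pentagonal (+ suc n)) f m) + - 1ℤ * s * shift (pentagonal -[1+ n ]) f m
      ≡⟨ regroup (pentagonalSum n f m) s _ _ ⟩
    pentagonalSum (suc n) f m
      ∎
    where
    open ≡-Reasoning
    s T : ℤ
    s = signPow (+ n)
    T = shanksTerm (suc n) (suc n) m
    last-boundary : shift (shanksExponent n (suc n)) (poch (suc n) (n ℕ.∸ n) f) m ≡ shift (pentagonal (+ suc n)) f m
    last-boundary = cong₂ (λ a l → shift a (poch (suc n) l f) m) (exponent n (tri n)) (ℕ.n∸n≡0 n)
      where
      exponent : ∀ n t → n ℕ.* suc n ℕ.+ (suc n ℕ.+ t) ≡ suc n ℕ.* suc n ℕ.+ t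
      exponent = ℕ-solve-∀
    last-term : shift (pentagonal -[1+ n ]) (poch (suc (suc n)) (n ℕ.∸ n) f) m ≡ shift (pentagonal -[1+ n ]) f m
    last-term = cong (λ l → shift (pentagonal -[1+ n ]) (poch (suc (suc n)) l f) m) (ℕ.n∸n≡0 n)
    regroup : ∀ E s a b → E + (0ℤ - s * a) + - 1ℤ * s * b ≡ - 1ℤ * s * a + (- 1ℤ * s * b + E)
    regroup = solve-∀

  pentagonalSum-poch : ∀ {N m} → m ≤ N → pentagonalSum N f m ≡ poch 1 N f m
  pentagonalSum-poch {N} {m} m≤N = begin
    pentagonalSum N f m                                              ≡⟨ shanks N m ⟨
    shanksTerm N 0 m + (∑[ k ∈ applyUpTo suc N ] shanksTerm N k m)   ≡⟨ cong₂ _+_ first-term rest ⟩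
    poch 1 N f m + 0ℤ                                                ≡⟨ +-identityʳ _ ⟩
    poch 1 N f m                                                     ∎
    where
    open ≡-Reasoning
    first-term : shanksTerm N 0 m ≡ poch 1 N f m
    first-term = trans (*-identityˡ _)
      (cong (λ a → shift a (poch 1 N f) m) (trans (ℕ.+-identityʳ (N ℕ.* 0)) (ℕ.*-zeroʳ N)))
    rest : ∑[ k ∈ applyUpTo suc N ] shanksTerm N k m ≡ 0ℤ
    rest = trans (∑-range-cong vanish) (∑-0 (applyUpTo suc N))
      where
      vanish : ∀ {k} → 1 ≤ k → k ≤ N → shanksTerm N k m ≡ 0ℤ
      vanish {suc k} _ _ = trans (cong (signPow (+ suc k) *_) (shift-< _ _ m<exponent)) (*-zeroʳ (signPow (+ suc k)))
        where
        m<exponent : m < shanksExponent N (suc k)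
        m<exponent = ℕ.≤-<-trans m≤N (ℕ.≤-<-trans (ℕ.m≤m*n N (suc k)) (ℕ.m<m+n (N ℕ.* suc k) (s≤s z≤n)))

-- Partitions into bounded parts

partitionSum : (List ℕ → ℕ) → ℕ → Series
partitionSum g m n = ∑[ ps ∈ go n m n ] + g ps

∑-go-suc : ∀ (h : List ℕ → ℤ) f m n →
  ∑ (go (suc f) m (suc n)) h
    ≡ ∑[ p ∈ applyUpTo suc (m ℕ.⊓ suc n) ] ∑[ ps ∈ go f p (suc n ℕ.∸ p) ] h (p ∷ ps)
∑-go-suc h f m n =
  trans (∑-concatMap (λ p → map (p ∷_) (go f p (suc n ℕ.∸ p))) (applyUpTo suc (m ℕ.⊓ suc n)) h)
        (∑-cong {xs = applyUpTo suc (m ℕ.⊓ suc n)} λ {p} _ → ∑-map (p ∷_) (go f p (suc n ℕ.∸ p)) h)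

∑-go-fuel : ∀ (h : List ℕ → ℤ) {f f′} m n → n ≤ f → n ≤ f′ → ∑ (go f m n) h ≡ ∑ (go f′ m n) h
∑-go-fuel h                  m zero    _         _          = refl
∑-go-fuel h {suc f} {suc f′} m (suc n) (s≤s n≤f) (s≤s n≤f′) =
  trans (∑-go-suc h f m n) (trans (∑-cong {xs = applyUpTo suc (m ℕ.⊓ suc n)} same) (sym (∑-go-suc h f′ m n)))
  where
  same : ∀ {p} → p ∈ applyUpTo suc (m ℕ.⊓ suc n) →
         ∑[ ps ∈ go f p (suc n ℕ.∸ p) ] h (p ∷ ps) ≡ ∑[ ps ∈ go f′ p (suc n ℕ.∸ p) ] h (p ∷ ps)
  same p∈ with ∈-applyUpTo⁻ suc p∈
  ... | p′ , _ , refl = ∑-go-fuel (h ∘ (suc p′ ∷_)) (suc p′) (n ℕ.∸ p′)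
                          (ℕ.≤-trans (ℕ.m∸n≤m n p′) n≤f) (ℕ.≤-trans (ℕ.m∸n≤m n p′) n≤f′)

partitionSum-≥ : ∀ g {m n} → n ≤ m → partitionSum g m n ≡ partitionSum g n n
partitionSum-≥ g {m} {zero}  _   = refl
partitionSum-≥ g {m} {suc n} n≤m = begin
  ∑ (go (suc n) m (suc n)) (+_ ∘ g)
    ≡⟨ ∑-go-suc (+_ ∘ g) n m n ⟩
  ∑[ p ∈ applyUpTo suc (m ℕ.⊓ suc n) ] ∑[ ps ∈ go n p (suc n ℕ.∸ p) ] + g (p ∷ ps)
    ≡⟨ cong (λ b → ∑[ p ∈ applyUpTo suc b ] ∑[ ps ∈ go n p (suc n ℕ.∸ p) ] + g (p ∷ ps))
            (trans (ℕ.m≥n⇒m⊓n≡n n≤m) (sym (ℕ.⊓-idem (suc n)))) ⟩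
  ∑[ p ∈ applyUpTo suc (suc n ℕ.⊓ suc n) ] ∑[ ps ∈ go n p (suc n ℕ.∸ p) ] + g (p ∷ ps)
    ≡⟨ ∑-go-suc (+_ ∘ g) n (suc n) n ⟨
  ∑ (go (suc n) (suc n) (suc n)) (+_ ∘ g)
    ∎
  where open ≡-Reasoning

partitionSum-suc : ∀ g m n → suc m ≤ n →
  partitionSum g (suc m) n ≡ partitionSum g m n + partitionSum (g ∘ (suc m ∷_)) (suc m) (n ℕ.∸ suc m)
partitionSum-suc g m (suc n) m<n = begin
  ∑ (go (suc n) (suc m) (suc n)) (+_ ∘ g)
    ≡⟨ ∑-go-suc (+_ ∘ g) n (suc m) n ⟩
  ∑[ p ∈ applyUpTo suc (suc m ℕ.⊓ suc n) ] parts p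
    ≡⟨ cong (λ b → ∑[ p ∈ applyUpTo suc b ] parts p) (ℕ.m≤n⇒m⊓n≡m m<n) ⟩
  ∑[ p ∈ applyUpTo suc (suc m) ] parts p
    ≡⟨ ∑-applyUpTo-suc suc m parts ⟩
  (∑[ p ∈ applyUpTo suc m ] parts p) + parts (suc m)
    ≡⟨ cong₂ _+_ (cong (λ b → ∑[ p ∈ applyUpTo suc b ] parts p) (sym (ℕ.m≤n⇒m⊓n≡m (ℕ.<⇒≤ m<n))))
                 (∑-go-fuel (+_ ∘ g ∘ (suc m ∷_)) (suc m) (n ℕ.∸ m) (ℕ.m∸n≤m n m) ℕ.≤-refl) ⟩
  (∑[ p ∈ applyUpTo suc (m ℕ.⊓ suc n) ] parts p) + partitionSum (g ∘ (suc m ∷_)) (suc m) (n ℕ.∸ m)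
    ≡⟨ cong (_+ partitionSum (g ∘ (suc m ∷_)) (suc m) (n ℕ.∸ m)) (∑-go-suc (+_ ∘ g) n m n) ⟨
  partitionSum g m (suc n) + partitionSum (g ∘ (suc m ∷_)) (suc m) (n ℕ.∸ m)
    ∎
  where
  open ≡-Reasoning
  parts : ℕ → ℤ
  parts p = ∑[ ps ∈ go n p (suc n ℕ.∸ p) ] + g (p ∷ ps)

partitionSum-suc-shift : ∀ g m n →
  partitionSum g (suc m) n ≡ partitionSum g m n + shift (suc m) (partitionSum (g ∘ (suc m ∷_)) (suc m)) n
partitionSum-suc-shift g m n with suc m ℕ.≤? n
... | yes m<n = trans (partitionSum-suc g m n m<n)
                      (cong (_+_ (partitionSum g m n)) (sym (shift-≥ (suc m) _ m<n)))
... | no  m≮n = begin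
  partitionSum g (suc m) n       ≡⟨ partitionSum-≥ g (ℕ.m≤n⇒m≤1+n n≤m) ⟩
  partitionSum g n n             ≡⟨ partitionSum-≥ g n≤m ⟨
  partitionSum g m n             ≡⟨ +-identityʳ _ ⟨
  partitionSum g m n + 0ℤ        ≡⟨ cong (_+_ (partitionSum g m n)) (shift-< (suc m) _ (s≤s n≤m)) ⟨
  partitionSum g m n + shift (suc m) (partitionSum (g ∘ (suc m ∷_)) (suc m)) n
    ∎
  where
  open ≡-Reasoning
  n≤m : n ≤ m
  n≤m = ℕ.≤-pred (ℕ.≰⇒> m≮n)

partitionSum-cong : ∀ {g g′} m → g ≗ g′ → partitionSum g m ≗ partitionSum g′ m
partitionSum-cong m g≗g′ n = ∑-cong {xs = go n m n} λ {ps} _ → cong +_ (g≗g′ ps)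

partitionSum-[1-q^] : ∀ g m → (∀ ps → g (suc m ∷ ps) ≡ g ps) →
                      [1-q^ suc m ] partitionSum g (suc m) ≗ partitionSum g m
partitionSum-[1-q^] g m g-cons n = begin
  partitionSum g (suc m) n - shift (suc m) (partitionSum g (suc m)) n
    ≡⟨ cong (_- shift (suc m) (partitionSum g (suc m)) n) (partitionSum-suc-shift g m n) ⟩
  partitionSum g m n + shift (suc m) (partitionSum (g ∘ (suc m ∷_)) (suc m)) n - shift (suc m) (partitionSum g (suc m)) n
    ≡⟨ cong (λ x → partitionSum g m n + x - shift (suc m) (partitionSum g (suc m)) n)
            (shift-cong (suc m) (partitionSum-cong (suc m) g-cons) n) ⟩
  partitionSum g m n + shift (suc m) (partitionSum g (suc m)) n - shift (suc m) (partitionSum g (suc m)) n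
    ≡⟨ plus-minus (partitionSum g m n) _ ⟩
  partitionSum g m n
    ∎
  where
  open ≡-Reasoning
  plus-minus : ∀ a b → a + b - b ≡ a
  plus-minus = solve-∀

partitionCount : ℕ → Series
partitionCount = partitionSum (λ _ → 1)

poch-partitionCount : ∀ N → poch 1 N (partitionCount N) ≗ δ
poch-partitionCount zero    zero    = refl
poch-partitionCount zero    (suc n) = refl
poch-partitionCount (suc N) n = begin
  poch 1 (suc N) (partitionCount (suc N)) n           ≡⟨ poch-suc 1 N (partitionCount (suc N)) n ⟩
  ([1-q^ suc N ] poch 1 N (partitionCount (suc N))) n ≡⟨ poch-[1-q^] 1 N (suc N) (partitionCount (suc N)) n ⟨
  poch 1 N ([1-q^ suc N ] partitionCount (suc N)) n
    ≡⟨ poch-cong 1 N (partitionSum-[1-q^] (λ _ → 1) N (λ _ → refl)) n ⟩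
  poch 1 N (partitionCount N) n                       ≡⟨ poch-partitionCount N n ⟩
  δ n                                                 ∎
  where open ≡-Reasoning

pentagonalSum-partitionCount : ∀ {N m} → m ≤ N → pentagonalSum N (partitionCount N) m ≡ δ m
pentagonalSum-partitionCount {N} {m} m≤N = trans (pentagonalSum-poch (partitionCount N) m≤N) (poch-partitionCount N m)

-- Parts repeated at least t times

atLeastCopies : ℕ → ℕ → List ℕ → ℕ
atLeastCopies t v ps = iverson (t ℕ.≤? count v ps)

iverson-cong : ∀ {P Q : Set} (p : Dec P) (q : Dec Q) → (P → Q) → (Q → P) → iverson p ≡ iverson q
iverson-cong (yes _) (yes _) _   _   = refl
iverson-cong (no  _) (no  _) _   _   = refl
iverson-cong (yes p) (no ¬q) p→q _   = contradiction (p→q p) ¬q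
iverson-cong (no ¬p) (yes q) _   q→p = contradiction (q→p q) ¬p

atLeastCopies-cons-≡ : ∀ t v ps → atLeastCopies (suc t) v (v ∷ ps) ≡ atLeastCopies t v ps
atLeastCopies-cons-≡ t v ps rewrite filter-accept (ℕ._≟ v) {v} {ps} refl =
  iverson-cong (suc t ℕ.≤? suc (count v ps)) (t ℕ.≤? count v ps) ℕ.≤-pred s≤s

atLeastCopies-cons-≢ : ∀ t {v p} ps → p ≢ v → atLeastCopies t v (p ∷ ps) ≡ atLeastCopies t v ps
atLeastCopies-cons-≢ t {v} {p} ps p≢v rewrite filter-reject (ℕ._≟ v) {p} {ps} p≢v = refl

partitionSum-atLeastCopies-< : ∀ {v} m t → m < v → partitionSum (atLeastCopies (suc t) v) m ≗ λ _ → 0ℤ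
partitionSum-atLeastCopies-< zero    t _   zero    = refl
partitionSum-atLeastCopies-< zero    t _   (suc n) = refl
partitionSum-atLeastCopies-< {v} (suc m) t m<v =
  [1-q^]-injective (suc m) (s≤s z≤n) λ n → begin
    ([1-q^ suc m ] partitionSum (atLeastCopies (suc t) v) (suc m)) n
      ≡⟨ partitionSum-[1-q^] _ m (λ ps → atLeastCopies-cons-≢ (suc t) ps (ℕ.<⇒≢ m<v)) n ⟩
    partitionSum (atLeastCopies (suc t) v) m n
      ≡⟨ partitionSum-atLeastCopies-< m t (ℕ.<⇒≤ m<v) n ⟩
    0ℤ
      ≡⟨ cong (_-_ 0ℤ) (shift-0 (suc m) n) ⟨
    ([1-q^ suc m ] (λ _ → 0ℤ)) n
      ∎
  where open ≡-Reasoning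

partitionSum-atLeastCopies-≤ : ∀ {v} m t → 1 ≤ v → v ≤ m →
  partitionSum (atLeastCopies t v) m ≗ shift (t ℕ.* v) (partitionCount m)
partitionSum-atLeastCopies-≤ {suc v} zero t 1≤v ()
partitionSum-atLeastCopies-≤ {v} (suc m) t 1≤v v≤1+m with ℕ.m≤n⇒m<n∨m≡n v≤1+m
... | inj₁ (s≤s v≤m) = [1-q^]-injective (suc m) (s≤s z≤n) λ n → begin
  ([1-q^ suc m ] partitionSum (atLeastCopies t v) (suc m)) n
    ≡⟨ partitionSum-[1-q^] _ m (λ ps → atLeastCopies-cons-≢ t ps (ℕ.>⇒≢ (s≤s v≤m))) n ⟩
  partitionSum (atLeastCopies t v) m n
    ≡⟨ partitionSum-atLeastCopies-≤ m t 1≤v v≤m n ⟩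
  shift (t ℕ.* v) (partitionCount m) n
    ≡⟨ shift-cong (t ℕ.* v) (partitionSum-[1-q^] (λ _ → 1) m (λ _ → refl)) n ⟨
  shift (t ℕ.* v) ([1-q^ suc m ] partitionCount (suc m)) n
    ≡⟨ shift-[1-q^] (t ℕ.* v) (suc m) (partitionCount (suc m)) n ⟩
  ([1-q^ suc m ] shift (t ℕ.* v) (partitionCount (suc m))) n
    ∎
  where open ≡-Reasoning
... | inj₂ refl = copies t
  where
  open ≡-Reasoning
  copies : ∀ t → partitionSum (atLeastCopies t (suc m)) (suc m) ≗ shift (t ℕ.* suc m) (partitionCount (suc m))
  copies zero    n = refl
  copies (suc t) n = begin
    partitionSum (atLeastCopies (suc t) (suc m)) (suc m) n
      ≡⟨ partitionSum-suc-shift _ m n ⟩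
    partitionSum (atLeastCopies (suc t) (suc m)) m n
      + shift (suc m) (partitionSum (atLeastCopies (suc t) (suc m) ∘ (suc m ∷_)) (suc m)) n
      ≡⟨ cong₂ _+_ (partitionSum-atLeastCopies-< m t ℕ.≤-refl n)
                   (shift-cong (suc m) (partitionSum-cong (suc m) (atLeastCopies-cons-≡ t (suc m))) n) ⟩
    0ℤ + shift (suc m) (partitionSum (atLeastCopies t (suc m)) (suc m)) n
      ≡⟨ +-identityˡ _ ⟩
    shift (suc m) (partitionSum (atLeastCopies t (suc m)) (suc m)) n
      ≡⟨ shift-cong (suc m) (copies t) n ⟩
    shift (suc m) (shift (t ℕ.* suc m) (partitionCount (suc m))) n
      ≡⟨ shift-shift (suc m) (t ℕ.* suc m) (partitionCount (suc m)) n ⟩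
    shift (suc t ℕ.* suc m) (partitionCount (suc m)) n
      ∎

-- distinctRepeatedSum sums a summand that is local to its definition; this names it.
distinctRepeatedSum-summand : ∀ k n ps →
  Σ[ h ∈ (ℕ → ℕ) ] distinctRepeatedSum k n ps ≡ sum (map h (applyUpTo suc n))
distinctRepeatedSum-summand k n ps = _ , refl

distinctRepeatedSum-summand-≗ : ∀ k n ps →
  proj₁ (distinctRepeatedSum-summand k n ps) ≗ λ v → v ℕ.* atLeastCopies k v ps
distinctRepeatedSum-summand-≗ k n ps v with k ℕ.≤? count v ps
... | yes _ = sym (ℕ.*-identityʳ v)
... | no  _ = sym (ℕ.*-zeroʳ v)

distinctRepeatedSum-atLeastCopies : ∀ k n ps →
  + distinctRepeatedSum k n ps ≡ ∑[ v ∈ applyUpTo suc n ] + v * + atLeastCopies k v ps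
distinctRepeatedSum-atLeastCopies k n ps =
  trans (pos-sum-map (proj₁ (distinctRepeatedSum-summand k n ps)) (applyUpTo suc n))
        (∑-cong {xs = applyUpTo suc n} λ {v} _ →
          trans (cong +_ (distinctRepeatedSum-summand-≗ k n ps v)) (pos-* v _))

b-pos : ∀ k m → b k (+ m) ≡ + bℕ k m
b-pos k zero    = refl
b-pos k (suc m) = refl

b-partitionCount : ∀ k {m N} → 1 ≤ k → m ≤ N →
  b k (+ m) ≡ ∑[ v ∈ applyUpTo suc N ] + v * shift (k ℕ.* v) (partitionCount N) m
b-partitionCount k {m} {N} 1≤k m≤N = begin
  b k (+ m)
    ≡⟨ b-pos k m ⟩
  + sum (map (distinctRepeatedSum k m) (go m m m))
    ≡⟨ pos-sum-map (distinctRepeatedSum k m) (go m m m) ⟩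
  ∑[ ps ∈ go m m m ] + distinctRepeatedSum k m ps
    ≡⟨ ∑-cong {xs = go m m m} (λ {ps} _ → distinctRepeatedSum-atLeastCopies k m ps) ⟩
  ∑[ ps ∈ go m m m ] ∑[ v ∈ applyUpTo suc m ] + v * + atLeastCopies k v ps
    ≡⟨ ∑-comm (go m m m) (applyUpTo suc m) _ ⟩
  ∑[ v ∈ applyUpTo suc m ] ∑[ ps ∈ go m m m ] + v * + atLeastCopies k v ps
    ≡⟨ ∑-cong {xs = applyUpTo suc m} (λ {v} _ → ∑-*ˡ (+ v) (go m m m) (λ ps → + atLeastCopies k v ps)) ⟩
  ∑[ v ∈ applyUpTo suc m ] + v * partitionSum (atLeastCopies k v) m m
    ≡⟨ ∑-range-cong (λ {v} 1≤v v≤m → cong (+ v *_) (count-copies v 1≤v v≤m)) ⟩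
  ∑[ v ∈ applyUpTo suc m ] + v * shift (k ℕ.* v) (partitionCount N) m
    ≡⟨ ∑-range-extend _ m≤N (λ v m<v → trans (cong (+ v *_) (shift-< _ _ (below v m<v))) (*-zeroʳ (+ v))) ⟨
  ∑[ v ∈ applyUpTo suc N ] + v * shift (k ℕ.* v) (partitionCount N) m
    ∎
  where
  open ≡-Reasoning
  count-copies : ∀ v → 1 ≤ v → v ≤ m →
    partitionSum (atLeastCopies k v) m m ≡ shift (k ℕ.* v) (partitionCount N) m
  count-copies v 1≤v v≤m = begin
    partitionSum (atLeastCopies k v) m m   ≡⟨ partitionSum-≥ _ m≤N ⟨
    partitionSum (atLeastCopies k v) N m   ≡⟨ partitionSum-atLeastCopies-≤ N k 1≤v (ℕ.≤-trans v≤m m≤N) m ⟩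
    shift (k ℕ.* v) (partitionCount N) m   ∎
  below : ∀ v → m < v → m < k ℕ.* v
  below v m<v = ℕ.<-≤-trans m<v (ℕ.m≤n*m v k {{ℕ.>-nonZero 1≤k}})

-- The pentagonal sum of b_k

tri-double : ∀ k → 2 ℕ.* tri k ≡ k ℕ.* suc k
tri-double zero    = refl
tri-double (suc k) = begin
  2 ℕ.* (suc k ℕ.+ tri k)            ≡⟨ ℕ.*-distribˡ-+ 2 (suc k) (tri k) ⟩
  2 ℕ.* suc k ℕ.+ 2 ℕ.* tri k        ≡⟨ cong (2 ℕ.* suc k ℕ.+_) (tri-double k) ⟩
  2 ℕ.* suc k ℕ.+ k ℕ.* suc k        ≡⟨ ℕ.*-distribʳ-+ (suc k) 2 k ⟨
  suc (suc k) ℕ.* suc k              ≡⟨ ℕ.*-comm (suc (suc k)) (suc k) ⟩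
  suc k ℕ.* suc (suc k)              ∎
  where open ≡-Reasoning

pos-double-square-+ : ∀ s t → + (2 ℕ.* (s ℕ.* s ℕ.+ t)) ≡ + 2 * (+ s * + s) + + (2 ℕ.* t)
pos-double-square-+ s t = begin
  + (2 ℕ.* (s ℕ.* s ℕ.+ t))           ≡⟨ cong +_ (ℕ.*-distribˡ-+ 2 (s ℕ.* s) t) ⟩
  + (2 ℕ.* (s ℕ.* s) ℕ.+ 2 ℕ.* t)     ≡⟨ pos-+ (2 ℕ.* (s ℕ.* s)) (2 ℕ.* t) ⟩
  + (2 ℕ.* (s ℕ.* s)) + + (2 ℕ.* t)
    ≡⟨ cong (_+ + (2 ℕ.* t)) (trans (pos-* 2 (s ℕ.* s)) (cong (+ 2 *_) (pos-* s s))) ⟩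
  + 2 * (+ s * + s) + + (2 ℕ.* t)     ∎
  where open ≡-Reasoning

pos-tri-double : ∀ k → + (2 ℕ.* tri k) ≡ + k * + suc k
pos-tri-double k = trans (cong +_ (tri-double k)) (pos-* k (suc k))

double-pentagonal : ∀ j → + (2 ℕ.* pentagonal j) ≡ j * (+ 3 * j - 1ℤ)
double-pentagonal (+ zero)  = refl
double-pentagonal (+ suc i) = begin
  + (2 ℕ.* (suc i ℕ.* suc i ℕ.+ tri i))           ≡⟨ pos-double-square-+ (suc i) (tri i) ⟩
  + 2 * (+ suc i * + suc i) + + (2 ℕ.* tri i)     ≡⟨ cong (_+_ (+ 2 * (+ suc i * + suc i))) (pos-tri-double i) ⟩
  + 2 * (+ suc i * + suc i) + + i * + suc i       ≡⟨ polynomial (+ i) ⟩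
  + suc i * (+ 3 * + suc i - 1ℤ)                  ∎
  where
  open ≡-Reasoning
  polynomial : ∀ x → + 2 * ((1ℤ + x) * (1ℤ + x)) + x * (1ℤ + x) ≡ (1ℤ + x) * (+ 3 * (1ℤ + x) - 1ℤ)
  polynomial = solve-∀
double-pentagonal -[1+ i ]  = begin
  + (2 ℕ.* (suc i ℕ.* suc i ℕ.+ tri (suc i)))
    ≡⟨ pos-double-square-+ (suc i) (tri (suc i)) ⟩
  + 2 * (+ suc i * + suc i) + + (2 ℕ.* tri (suc i))
    ≡⟨ cong (_+_ (+ 2 * (+ suc i * + suc i))) (pos-tri-double (suc i)) ⟩
  + 2 * (+ suc i * + suc i) + + suc i * + suc (suc i)
    ≡⟨ polynomial (+ i) ⟩
  - + suc i * (+ 3 * - + suc i - 1ℤ)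
    ∎
  where
  open ≡-Reasoning
  polynomial : ∀ x → + 2 * ((1ℤ + x) * (1ℤ + x)) + (1ℤ + x) * (+ 2 + x)
                   ≡ - (1ℤ + x) * (+ 3 * - (1ℤ + x) - 1ℤ)
  polynomial = solve-∀

pent-pentagonal : ∀ j → pent j ≡ + pentagonal j
pent-pentagonal j = begin
  (j * (+ 3 * j - 1ℤ)) ZD./ + 2        ≡⟨ cong (ZD._/ + 2) (double-pentagonal j) ⟨
  + (2 ℕ.* pentagonal j) ZD./ + 2      ≡⟨ ZD.div-pos-is-/ℕ (+ (2 ℕ.* pentagonal j)) 2 ⟩
  + ((2 ℕ.* pentagonal j) ℕ./ 2)       ≡⟨ cong (λ x → + (x ℕ./ 2)) (ℕ.*-comm 2 (pentagonal j)) ⟩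
  + ((pentagonal j ℕ.* 2) ℕ./ 2)       ≡⟨ cong +_ (ℕ.m*n/n≡m (pentagonal j) 2) ⟩
  + pentagonal j                       ∎
  where open ≡-Reasoning

b-⊖ : ∀ k n p → b k (n ℤ.⊖ p) ≡ shift p (λ m → b k (+ m)) n
b-⊖ k n       zero    = refl
b-⊖ k zero    (suc p) = refl
b-⊖ k (suc n) (suc p) = trans (cong (b k) ([1+m]⊖[1+n]≡m⊖n n p)) (b-⊖ k n p)

summand-shift : ∀ k n j → summand k n j ≡ signPow j * shift (pentagonal j) (λ m → b k (+ m)) n
summand-shift k n j = cong (signPow j *_) (begin
  b k (+ n - pent j)             ≡⟨ cong (λ p → b k (+ n - p)) (pent-pentagonal j) ⟩
  b k (+ n - + pentagonal j)     ≡⟨ cong (b k) (m-n≡m⊖n n (pentagonal j)) ⟩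
  b k (n ℤ.⊖ pentagonal j)       ≡⟨ b-⊖ k n (pentagonal j) ⟩
  shift (pentagonal j) (λ m → b k (+ m)) n ∎)
  where open ≡-Reasoning

symSum-summand : ∀ k {n N} → 1 ≤ k → n ≤ N →
  symSum (summand k n) N ≡ ∑[ v ∈ applyUpTo suc N ] + v * shift (k ℕ.* v) δ n
symSum-summand k {n} {N} 1≤k n≤N = begin
  symSum (summand k n) N
    ≡⟨ symSum-∑ (summand k n) N ⟩
  ∑[ j ∈ symRange N ] summand k n j
    ≡⟨ ∑-cong {xs = symRange N} (λ {j} _ → summand-shift k n j) ⟩
  pentagonalSum N (λ m → b k (+ m)) n
    ≡⟨ pentagonalSum-local N n (λ m≤n → b-partitionCount k 1≤k (ℕ.≤-trans m≤n n≤N)) ⟩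
  pentagonalSum N (λ m → ∑[ v ∈ applyUpTo suc N ] + v * shift (k ℕ.* v) (partitionCount N) m) n
    ≡⟨ pentagonalSum-∑ N (applyUpTo suc N) +_ (λ v → shift (k ℕ.* v) (partitionCount N)) n ⟩
  ∑[ v ∈ applyUpTo suc N ] + v * pentagonalSum N (shift (k ℕ.* v) (partitionCount N)) n
    ≡⟨ ∑-cong {xs = applyUpTo suc N}
         (λ {v} _ → cong (+ v *_) (pentagonalSum-shift N (k ℕ.* v) (partitionCount N) n)) ⟩
  ∑[ v ∈ applyUpTo suc N ] + v * shift (k ℕ.* v) (pentagonalSum N (partitionCount N)) n
    ≡⟨ ∑-cong {xs = applyUpTo suc N} (λ {v} _ → cong (+ v *_) (shift-local (k ℕ.* v) n
         (λ m≤n → pentagonalSum-partitionCount (ℕ.≤-trans m≤n n≤N)))) ⟩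
  ∑[ v ∈ applyUpTo suc N ] + v * shift (k ℕ.* v) δ n
    ∎
  where open ≡-Reasoning

∑-shift-δ : ∀ k n N .{{_ : NonZero k}} → 1 ≤ n → n ≤ N →
  ∑[ v ∈ applyUpTo suc N ] + v * shift (k ℕ.* v) δ n ≡ rhs k n
-- Once n % k ≟ 0 is decided, rhs k n computes to 1ℤ * + (n / k), respectively to 0ℤ.
∑-shift-δ k n N 1≤n n≤N with n ℕ.% k ℕ.≟ 0
... | yes k∣n = begin
  ∑[ v ∈ applyUpTo suc N ] + v * shift (k ℕ.* v) δ n
    ≡⟨ ∑-range-single _ 1≤q (ℕ.≤-trans (ℕ.m/n≤m n k) n≤N) vanish ⟩
  + q * shift (k ℕ.* q) δ n
    ≡⟨ cong (λ s → + q * shift s δ n) kq≡n ⟩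
  + q * shift n δ n
    ≡⟨ cong (+ q *_) (shift-δ-≡ n) ⟩
  + q * 1ℤ
    ≡⟨ *-comm (+ q) 1ℤ ⟩
  1ℤ * + q
    ∎
  where
  open ≡-Reasoning
  q : ℕ
  q = n ℕ./ k
  kq≡n : k ℕ.* q ≡ n
  kq≡n = sym (trans (ℕ.m≡m%n+[m/n]*n n k) (trans (cong (ℕ._+ q ℕ.* k) k∣n) (ℕ.*-comm q k)))
  vanish : ∀ v → v ≢ q → + v * shift (k ℕ.* v) δ n ≡ 0ℤ
  vanish v v≢q = trans (cong (+ v *_) (shift-δ-≢ λ kv≡n → v≢q (ℕ.*-cancelˡ-≡ v q k (trans kv≡n (sym kq≡n)))))
                       (*-zeroʳ (+ v))
  1≤q : 1 ≤ q
  1≤q with q | kq≡n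
  ... | zero  | k0≡n = contradiction (trans (sym k0≡n) (ℕ.*-zeroʳ k)) (ℕ.>⇒≢ 1≤n)
  ... | suc _ | _    = s≤s z≤n
... | no  k∤n = trans (∑-cong {xs = applyUpTo suc N} (λ {v} _ → vanish v)) (∑-0 (applyUpTo suc N))
  where
  vanish : ∀ v → + v * shift (k ℕ.* v) δ n ≡ 0ℤ
  vanish v = trans (cong (+ v *_) (shift-δ-≢ λ kv≡n →
    k∤n (subst (λ x → x ℕ.% k ≡ 0) (trans (ℕ.*-comm v k) kv≡n) (ℕ.m*n%n≡0 v k)))) (*-zeroʳ (+ v))

corollary2p7 : (k n : ℕ) → .{{_ : NonZero k}} → .{{_ : NonZero n}} →
    (N : ℕ) → n ≤ N → symSum (summand k n) N ≡ rhs k n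
corollary2p7 k n N n≤N = begin
  symSum (summand k n) N                               ≡⟨ symSum-summand k (ℕ.>-nonZero⁻¹ k) n≤N ⟩
  ∑[ v ∈ applyUpTo suc N ] + v * shift (k ℕ.* v) δ n   ≡⟨ ∑-shift-δ k n N (ℕ.>-nonZero⁻¹ n) n≤N ⟩
  rhs k n                                              ∎
  where open ≡-Reasoning
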